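{- Let $A$ be a type and let $A_{rw}$ be the structure whose objects are the elements $a : A$ and whose arrows $s : a\to b$ are the computational paths $a =_s b : A$. Define composition of $s:a\to b$ and $r:b\to c$ by $r\circ s = \tau(s,r) : a\to c$, and the identity at $a$ by $1_a=\rho_a$ (the reflexive path $a=_\rho a$). Then $A_{rw}$ is a weak category: for all $s:a\to b$, $r:b\to c$, $t:c\to d$ we have $t\circ(r\circ s) =_{rw} (t\circ r)\circ s$ and $s\circ 1_a =_{rw} s =_{rw} 1_b\circ s$, i.e. the associativity and unit laws hold up to rw-equality.
   Context: For elements $a,b$ of a type $A$, a computational path (sequence of rewrites) $t$ from $a$ to $b$, written $a =_t b : A$, is a finite sequence of definitional equalities (rewrites justified by the $\lambda\beta\eta$-equality axioms and change of bound variables) from $a$ to $b$. Paths are written as terms: $\rho$ (reflexivity: $a=_\rho a$), $\sigma(t)$ (symmetry: from $a=_t b$ get $b=_{\sigma(t)} a$), $\tau(t,u)$ (transitivity: from $a=_t b$ and $b=_u c$ get $a=_{\tau(t,u)} c$). An rw-rule is a rewrite rule of the term rewriting system LND$_{EQ}$-TRS on path terms; among them are $\sigma(\rho)\rhd_{sr}\rho$, $\sigma(\sigma(r))\rhd_{ss} r$, $\tau(r,\sigma(r))\rhd_{tr}\rho$, $\tau(\sigma(r),r)\rhd_{tsr}\rho$, $\tau(r,\rho)\rhd_{trr} r$, $\tau(\rho,r)\rhd_{tlr} r$, $\tau(\tau(t,r),s)\rhd_{tt}\tau(t,\tau(r,s))$. $a\rhd_{1rw} b$ means $b$ is obtained from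 $a$ by one application of an rw-rule, and $a=_{rw} b$ (rw-equality) means there is a finite sequence $R_0\equiv a,\dots,R_n\equiv b$ with $R_i\rhd_{1rw}R_{i+1}$ or $R_{i+1}\rhd_{1rw}R_i$ for each $i$. -}

module Defs where

open import Level using (Level; _⊔_)

-- The basic definitional-equality
-- rewrites (βη-steps, α-renaming) between elements of A are abstracted as
-- an arbitrary relation  _↝_  on A.
module _ {a ℓ : Level} {A : Set a} (_↝_ : A → A → Set ℓ) where

  data Path : A → A → Set (a ⊔ ℓ) where
    step : ∀ {x y} → x ↝ y → Path x y
    ρ    : ∀ {x} → Path x x
    σ    : ∀ {x y} → Path x y → Path y x
    τ    : ∀ {x y z} → Path x y → Path y z → Path x z

  infix 4 _▷1rw_
  data _▷1rw_ : ∀ {x y} → Path x y → Path x y → Set (a ⊔ ℓ) where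
    sr  : ∀ {x} → σ (ρ {x}) ▷1rw ρ
    ss  : ∀ {x y} (r : Path x y) → σ (σ r) ▷1rw r
    tr  : ∀ {x y} (r : Path x y) → τ r (σ r) ▷1rw ρ
    tsr : ∀ {x y} (r : Path x y) → τ (σ r) r ▷1rw ρ
    trr : ∀ {x y} (r : Path x y) → τ r ρ ▷1rw r
    tlr : ∀ {x y} (r : Path x y) → τ ρ r ▷1rw r
    tt  : ∀ {w x y z} (t : Path w x) (r : Path x y) (s : Path y z) →
          τ (τ t r) s ▷1rw τ t (τ r s)
    congσ : ∀ {x y} {p q : Path x y} → p ▷1rw q → σ p ▷1rw σ q
    congτˡ : ∀ {x y z} {p q : Path x y} (u : Path y z) → p ▷1rw q → τ p u ▷1rw τ q u
    congτʳ : ∀ {x y z} (u : Path x y) {p q : Path y z} → p ▷1rw q → τ u p ▷1rw τ u q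

  infix 4 _=rw_
  data _=rw_ {x y : A} : Path x y → Path x y → Set (a ⊔ ℓ) where
    done : ∀ {p} → p =rw p
    fwd  : ∀ {p q r} → p ▷1rw q → q =rw r → p =rw r
    bwd  : ∀ {p q r} → q ▷1rw p → q =rw r → p =rw r

  infixr 9 _∘_
  _∘_ : ∀ {x y z} → Path y z → Path x y → Path x z
  r ∘ s = τ s r

  1[_] : (x : A) → Path x x
  1[ x ] = ρ

-- Each law holds up to rw-equality because it is witnessed by a single
-- rw-rule of LND_EQ-TRS applied at the root of the path term:
--   associativity  by  tt  : τ (τ s r) t ▷ τ s (τ r t),
--   left unit      by  tlr : τ ρ s ▷ s,
--   right unit     by  trr : τ s ρ ▷ s.
module Submission where

open import Defs
open import Level using (Level)
open import Data.Product using (_×_; _,_)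

module WeakCategory {ℓa ℓ : Level} {A : Set ℓa} (_↝_ : A → A → Set ℓ) where

  ▷⇒=rw : ∀ {x y} {p q : Path _↝_ x y} → _▷1rw_ _↝_ p q → _=rw_ _↝_ p q
  ▷⇒=rw p▷q = fwd p▷q done

  ◁⇒=rw : ∀ {x y} {p q : Path _↝_ x y} → _▷1rw_ _↝_ q p → _=rw_ _↝_ p q
  ◁⇒=rw q▷p = bwd q▷p done

  ∘-assoc : ∀ {w x y z} (s : Path _↝_ w x) (r : Path _↝_ x y) (t : Path _↝_ y z) →
            _=rw_ _↝_ (_∘_ _↝_ t (_∘_ _↝_ r s)) (_∘_ _↝_ (_∘_ _↝_ t r) s)
  ∘-assoc s r t = ▷⇒=rw (tt s r t)

  ∘-identityʳ : ∀ {x y} (s : Path _↝_ x y) → _=rw_ _↝_ (_∘_ _↝_ s (1[_] _↝_ x)) s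
  ∘-identityʳ s = ▷⇒=rw (tlr s)

  ∘-identityˡ : ∀ {x y} (s : Path _↝_ x y) → _=rw_ _↝_ s (_∘_ _↝_ (1[_] _↝_ y) s)
  ∘-identityˡ s = ◁⇒=rw (trr s)

proposition3p1 : ∀ {ℓa ℓ : Level} {A : Set ℓa} (_↝_ : A → A → Set ℓ)
    {a b c d : A} (s : Path _↝_ a b) (r : Path _↝_ b c) (t : Path _↝_ c d) →
    _=rw_ _↝_ (_∘_ _↝_ t (_∘_ _↝_ r s)) (_∘_ _↝_ (_∘_ _↝_ t r) s)
    × _=rw_ _↝_ (_∘_ _↝_ s (1[_] _↝_ a)) s
    × _=rw_ _↝_ s (_∘_ _↝_ (1[_] _↝_ b) s)
proposition3p1 _↝_ s r t = ∘-assoc s r t , ∘-identityʳ s , ∘-identityˡ s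
  where open WeakCategory _↝_
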